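{- Let $H$ be an adjacency $k$-resolved graph of order $n_2$ and let $G$ be a non-trivial connected graph of order $n_1$, having $t_1$ true twin equivalence classes and diameter $D(G)<k$. If $\dim_l(G)=n_1-t_1$, then $\dim_l(G\boxtimes H)= n_2(n_1-t_1)$.
   Context: All graphs are finite, simple and connected; $d_G$ is shortest-path distance and $D(G)$ the diameter. Two vertices $u,v$ are true twins if $N_G[u]=N_G[v]$; the true twin equivalence classes are the classes of the relation $N_G[x]=N_G[y]$. A set $S$ is a local metric generator for $G$ if for every two adjacent vertices $x,y$ there is $s\in S$ with $d_G(s,x)\ne d_G(s,y)$; $\dim_l(G)$ is the minimum cardinality of a local metric generator. The strong product $G\boxtimes H$ has vertex set $V(G)\times V(H)$, with $(a,b)\sim(c,d)$ iff ($a=c$ and $b\sim d$) or ($b=d$ and $a\sim c$) or ($a\sim c$ and $b\sim d$). The interval $I[x,y]$ is the set of vertices on some shortest $x$–$y$ path. $H$ is adjacency $k$-resolved if for every two adjacent vertices $x,y$ of $H$ there is $w$ with ($d_H(y,w)\ge k$ and $x\in I[y,w]$) or ($d_H(x,w)\ge k$ and $y\in I[x,w]$). -}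

module Defs where

open import Data.Nat using (ℕ; zero; suc; _+_; _*_; _∸_; _≤_; _<_)
open import Data.Fin using (Fin; remQuot; _≟_)
open import Data.Fin.Subset using (Subset; _∈_; ∣_∣)
open import Data.Bool using (Bool; true; false; _∧_; _∨_)
open import Data.Product using (Σ; ∃; ∃-syntax; _×_; _,_; proj₁; proj₂)
open import Data.Sum using (_⊎_)
open import Function.Bundles using (_⇔_)
open import Function.Definitions using (Surjective)
open import Relation.Nullary using (¬_)
open import Relation.Nullary.Decidable using (⌊_⌋)
open import Relation.Binary.PropositionalEquality using (_≡_; _≢_; refl; sym)

record Graph (n : ℕ) : Set where
  field
    adj     : Fin n → Fin n → Bool
    adj-sym : ∀ x y → adj x y ≡ adj y x
    adj-irr : ∀ x → adj x x ≡ false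
open Graph public

module _ {n : ℕ} (G : Graph n) where

  Adj : Fin n → Fin n → Set
  Adj x y = adj G x y ≡ true

  data Walk : Fin n → Fin n → ℕ → Set where
    nil  : ∀ {u} → Walk u u 0
    cons : ∀ {u w v k} → Adj u w → Walk w v k → Walk u v (suc k)

  Connected : Set
  Connected = ∀ u v → ∃[ k ] Walk u v k

  Dist : Fin n → Fin n → ℕ → Set
  Dist u v k = Walk u v k × (∀ m → Walk u v m → k ≤ m)

  DiameterLt : ℕ → Set
  DiameterLt k = ∀ u v d → Dist u v d → d < k

  InInterval : Fin n → Fin n → Fin n → Set
  InInterval x y w = ∃[ c ] Dist y w c ×
    (∃[ a ] ∃[ b ] Walk y x a × Walk x w b × a + b ≡ c)

  Distinguishes : Fin n → Fin n → Fin n → Set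
  Distinguishes s x y = ∃[ a ] ∃[ b ] Dist s x a × Dist s y b × a ≢ b

  IsLocalMetricGenerator : Subset n → Set
  IsLocalMetricGenerator S =
    ∀ x y → Adj x y → ∃[ s ] s ∈ S × Distinguishes s x y

  LocalMetricDim : ℕ → Set
  LocalMetricDim m =
    (∃[ S ] IsLocalMetricGenerator S × ∣ S ∣ ≡ m) ×
    (∀ S → IsLocalMetricGenerator S → m ≤ ∣ S ∣)

  TrueTwins : Fin n → Fin n → Set
  TrueTwins u v = ∀ w → (w ≡ u ⊎ Adj u w) ⇔ (w ≡ v ⊎ Adj v w)

  -- G has exactly t true twin equivalence classes: there is a surjection
  -- onto Fin t whose fibres are exactly the true twin classes.
  TrueTwinClasses : ℕ → Set
  TrueTwinClasses t = Σ (Fin n → Fin t) λ f →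
    Surjective _≡_ _≡_ f × (∀ u v → (f u ≡ f v) ⇔ TrueTwins u v)

  AdjacencyResolved : ℕ → Set
  AdjacencyResolved k = ∀ x y → Adj x y → ∃[ w ]
    ((∃[ d ] Dist y w d × k ≤ d) × InInterval x y w
    ⊎ (∃[ d ] Dist x w d × k ≤ d) × InInterval y x w)

private
  eqb : ∀ {n} → Fin n → Fin n → Bool
  eqb a c = ⌊ a ≟ c ⌋

  eqb-sym : ∀ {n} (a c : Fin n) → eqb a c ≡ eqb c a
  eqb-sym a c with a ≟ c | c ≟ a
  ... | Relation.Nullary.yes _ | Relation.Nullary.yes _ = refl
  ... | Relation.Nullary.no _  | Relation.Nullary.no _  = refl
  ... | Relation.Nullary.yes p | Relation.Nullary.no q  = Data.Empty.⊥-elim (q (sym p))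
    where import Data.Empty
  ... | Relation.Nullary.no q  | Relation.Nullary.yes p = Data.Empty.⊥-elim (q (sym p))
    where import Data.Empty

  eqb-refl : ∀ {n} (a : Fin n) → eqb a a ≡ true
  eqb-refl a with a ≟ a
  ... | Relation.Nullary.yes _ = refl
  ... | Relation.Nullary.no q = Data.Empty.⊥-elim (q refl)
    where import Data.Empty

  spAdj : ∀ {n₁ n₂} → Graph n₁ → Graph n₂ → Fin n₁ × Fin n₂ → Fin n₁ × Fin n₂ → Bool
  spAdj G H (a , b) (c , d) =
    (eqb a c ∧ adj H b d) ∨ (eqb b d ∧ adj G a c) ∨ (adj G a c ∧ adj H b d)

  spAdj-sym : ∀ {n₁ n₂} (G : Graph n₁) (H : Graph n₂) p q → spAdj G H p q ≡ spAdj G H q p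
  spAdj-sym G H (a , b) (c , d)
    rewrite eqb-sym a c | eqb-sym b d | adj-sym G a c | adj-sym H b d = refl

  spAdj-irr : ∀ {n₁ n₂} (G : Graph n₁) (H : Graph n₂) p → spAdj G H p p ≡ false
  spAdj-irr G H (a , b)
    rewrite eqb-refl a | eqb-refl b | adj-irr G a | adj-irr H b = refl

-- Strong product G ⊠ H; vertex (a , b) is encoded as the element of
-- Fin (n₁ * n₂) whose remQuot is (a , b).
_⊠_ : ∀ {n₁ n₂} → Graph n₁ → Graph n₂ → Graph (n₁ * n₂)
_⊠_ {n₁} {n₂} G H = record
  { adj     = λ i j → spAdj G H (remQuot n₂ i) (remQuot n₂ j)
  ; adj-sym = λ i j → spAdj-sym G H (remQuot n₂ i) (remQuot n₂ j)
  ; adj-irr = λ i → spAdj-irr G H (remQuot n₂ i)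
  }

-- Lower bound: if N[u] = N[v] in G then (u , b) and (v , b) are true twins of G ⊠ H, and
-- adjacent true twins are at equal distance from every other vertex, so a local metric
-- generator contains all but one vertex of each true twin class of G ⊠ H; there are at
-- most n₂ t₁ such classes.
-- Upper bound: S × V(H) is a local metric generator whenever S is one for G.  Since
-- d((a , b) , (c , d)) = max (d_G(a , c)) (d_H(b , d)), a G-edge is resolved by (s , b) with
-- s resolving it in G, and an H-edge x y by (s₀ , w) with w the vertex given by
-- adjacency k-resolvedness: d_H(w , ·) ≥ k - 1 > D(G) on x, y, so the H-distance,
-- which differs by one, dominates the maximum.
module Submission where

open import Defs
open import Data.Nat using (ℕ; zero; suc; _+_; _*_; _∸_; _≤_; _<_; _⊔_; z≤n; s≤s; s≤s⁻¹)
open import Data.Nat.Properties using (anyUpTo?; ≮⇒≥; ≤-antisym; ≤-trans; <⇒≤; 1+n≰n; 1+n≢n; n≤1+n; m≤n⇒m≤1+n; m≤n+m; m≤n+o⇒m∸n≤o; +-suc; +-comm; +-monoʳ-≤; *-zeroʳ; *-suc; *-comm; *-distribˡ-∸; ⊔-lub; ⊔-identityʳ; m≤n⇒m⊔n≡n; module ≤-Reasoning)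
open import Data.Nat.Induction using (<-rec)
open import Data.Fin using (Fin; combine; remQuot; _≟_)
open import Data.Fin.Properties using (any?; suc-injective; 0≢1+n; remQuot-combine; combine-remQuot; combine-injective)
open import Data.Fin.Subset using (Subset; _∈_; _∉_; ∣_∣; inside; outside; ⊤; _-_)
open import Data.Fin.Subset.Properties using (∈⊤; x∈p∧x≢y⇒x∈p-y; x∈p⇒∣p-x∣<∣p∣; ∣⊤∣≡n; ∣⊥∣≡0)
open import Data.Vec using ([]; _∷_; _++_; concat; map; replicate; lookup; there)
open import Data.Vec.Properties using (lookup-concat; lookup-map; lookup-replicate; []=⇒lookup; lookup⇒[]=)
open import Data.Bool using (Bool; T; true; _∧_; _∨_)
open import Data.Bool.Properties using (T-≡; T-∧; T-∨) renaming (_≟_ to _≟ᵇ_)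
open import Data.Product using (∃-syntax; _×_; _,_; proj₁; proj₂)
open import Data.Product.Function.NonDependent.Propositional using (_×-⇔_)
open import Data.Sum using (_⊎_; inj₁; inj₂)
open import Data.Empty using (⊥-elim)
open import Function using (_∘_)
open import Function.Bundles using (_⇔_; mk⇔; Equivalence)
open import Function.Properties.Equivalence using () renaming (refl to ⇔-refl; sym to ⇔-sym; trans to ⇔-trans)
open import Relation.Nullary using (Dec; yes; no)
open import Relation.Nullary.Decidable using (⌊_⌋; _×-dec_; toWitness; fromWitness)
open import Relation.Unary using (Decidable)
open import Relation.Binary.PropositionalEquality

Minimum : ∀ {p} → (ℕ → Set p) → Set p
Minimum P = ∃[ d ] P d × (∀ m → P m → d ≤ m)

minimum : ∀ {p} {P : ℕ → Set p} → Decidable P → ∀ {k} → P k → Minimum P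
minimum {P = P} P? = <-rec (λ k → P k → Minimum P) descend _
  where
  descend : ∀ k → (∀ {j} → j < k → P j → Minimum P) → P k → Minimum P
  descend k smaller pk with anyUpTo? P? k
  ... | yes (j , j<k , pj) = smaller j<k pj
  ... | no none = k , pk , λ m pm → ≮⇒≥ (λ m<k → none (m , m<k , pm))

module _ {n : ℕ} (X : Graph n) where

  Adj⁼ : Fin n → Fin n → Set
  Adj⁼ u w = w ≡ u ⊎ Adj X u w

  Adj-sym : ∀ {x y} → Adj X x y → Adj X y x
  Adj-sym {x} {y} xy = trans (adj-sym X y x) xy

  Adj⇒≢ : ∀ {x y} → Adj X x y → x ≢ y
  Adj⇒≢ {x} xx refl with trans (sym xx) (adj-irr X x)
  ... | ()

  Walk-snoc : ∀ {u v w m} → Walk X u v m → Adj X v w → Walk X u w (suc m)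
  Walk-snoc nil vw = cons vw nil
  Walk-snoc (cons uv p) vw = cons uv (Walk-snoc p vw)

  Walk-reverse : ∀ {u v m} → Walk X u v m → Walk X v u m
  Walk-reverse nil = nil
  Walk-reverse (cons uv p) = Walk-snoc (Walk-reverse p) (Adj-sym uv)

  Walk? : ∀ m u v → Dec (Walk X u v m)
  Walk? zero u v with u ≟ v
  ... | yes refl = yes nil
  ... | no u≢v = no λ { nil → u≢v refl }
  Walk? (suc m) u v with any? (λ w → (adj X u w ≟ᵇ true) ×-dec Walk? m w v)
  ... | yes (w , uw , p) = yes (cons uw p)
  ... | no ∄w = no λ { (cons uw p) → ∄w (_ , uw , p) }

  Dist-refl : ∀ {u} → Dist X u u 0
  Dist-refl = nil , λ _ _ → z≤n

  Dist-sym : ∀ {u v d} → Dist X u v d → Dist X v u d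
  Dist-sym (p , shortest) = Walk-reverse p , λ m q → shortest m (Walk-reverse q)

  Dist-unique : ∀ {u v a b} → Dist X u v a → Dist X u v b → a ≡ b
  Dist-unique (p , p-shortest) (q , q-shortest) = ≤-antisym (p-shortest _ q) (q-shortest _ p)

  Dist-exists : Connected X → ∀ u v → ∃[ d ] Dist X u v d
  Dist-exists connected u v = minimum (λ m → Walk? m u v) (proj₂ (connected u v))

  Distinguishes-sym : ∀ {s x y} → Distinguishes X s x y → Distinguishes X s y x
  Distinguishes-sym (a , b , sx , sy , a≢b) = b , a , sy , sx , a≢b ∘ sym

  interval-neighbour : ∀ {x y w} → Adj X y x → InInterval X x y w →
                       ∃[ c ] Dist X y w (suc c) × Dist X x w c
  interval-neighbour yx (_ , _ , zero , _ , nil , _ , _) = ⊥-elim (Adj⇒≢ yx refl)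
  interval-neighbour yx (_ , yw , suc zero , b , _ , xw , refl) =
    b , yw , xw , λ m q → s≤s⁻¹ (proj₂ yw (suc m) (cons yx q))
  interval-neighbour yx (_ , (_ , shortest) , suc (suc a) , b , _ , xw , refl) =
    ⊥-elim (1+n≰n (≤-trans (s≤s (m≤n+m b a)) (s≤s⁻¹ (shortest (suc b) (cons yx xw)))))

  adjacencyResolved⇒far : ∀ {k x y} → AdjacencyResolved X k → Adj X x y →
    ∃[ w ] ∃[ c ] k ≤ suc c ×
      (Dist X w x c × Dist X w y (suc c) ⊎ Dist X w y c × Dist X w x (suc c))
  adjacencyResolved⇒far resolved xy with resolved _ _ xy
  ... | w , inj₁ ((_ , yw , k≤d) , x∈I[y,w]) with interval-neighbour (Adj-sym xy) x∈I[y,w]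
  ...   | c , yw′ , xw = w , c , subst (_ ≤_) (Dist-unique yw yw′) k≤d , inj₁ (Dist-sym xw , Dist-sym yw′)
  adjacencyResolved⇒far resolved xy
      | w , inj₂ ((_ , xw , k≤d) , y∈I[x,w]) with interval-neighbour xy y∈I[x,w]
  ...   | c , xw′ , yw = w , c , subst (_ ≤_) (Dist-unique xw xw′) k≤d , inj₂ (Dist-sym yw , Dist-sym xw′)

  closedNbhd⊆⇒dist≤ : ∀ {p q s α β} → (∀ z → Adj⁼ p z → Adj⁼ q z) → p ≢ s →
                      Dist X p s α → Dist X q s β → β ≤ α
  closedNbhd⊆⇒dist≤ _ p≢s (nil , _) _ = ⊥-elim (p≢s refl)
  closedNbhd⊆⇒dist≤ N[p]⊆N[q] _ (cons {w = z} pz zs , _) (_ , shortest)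
    with N[p]⊆N[q] z (inj₂ pz)
  ... | inj₁ refl = ≤-trans (shortest _ zs) (n≤1+n _)
  ... | inj₂ qz = shortest _ (cons qz zs)

  trueTwins⇒equidistant : ∀ {x y s α β} → TrueTwins X x y → s ≢ x → s ≢ y →
                          Dist X s x α → Dist X s y β → α ≡ β
  trueTwins⇒equidistant twins s≢x s≢y sx sy = ≤-antisym
    (closedNbhd⊆⇒dist≤ (λ z → Equivalence.from (twins z)) (s≢y ∘ sym) (Dist-sym sy) (Dist-sym sx))
    (closedNbhd⊆⇒dist≤ (λ z → Equivalence.to (twins z)) (s≢x ∘ sym) (Dist-sym sx) (Dist-sym sy))

  trueTwins⇒Adj : ∀ {x y} → TrueTwins X x y → x ≢ y → Adj X x y
  trueTwins⇒Adj {x} {y} twins x≢y with Equivalence.from (twins y) (inj₁ refl)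
  ... | inj₁ y≡x = ⊥-elim (x≢y (sym y≡x))
  ... | inj₂ xy = xy

  generator-meets-trueTwins : ∀ {S x y} → IsLocalMetricGenerator X S → TrueTwins X x y →
                              x ∉ S → y ∉ S → x ≡ y
  generator-meets-trueTwins {x = x} {y} generator twins x∉S y∉S with x ≟ y
  ... | yes x≡y = x≡y
  ... | no x≢y with generator x y (trueTwins⇒Adj twins x≢y)
  ...   | s , s∈S , _ , _ , sx , sy , a≢b =
    ⊥-elim (a≢b (trueTwins⇒equidistant twins (λ { refl → x∉S s∈S }) (λ { refl → y∉S s∈S }) sx sy))

edge-exists : ∀ {n} (X : Graph n) → Connected X → 2 ≤ n → ∃[ u ] ∃[ v ] Adj X u v
edge-exists {suc (suc _)} X connected (s≤s (s≤s _)) with connected Fin.zero (Fin.suc Fin.zero)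
... | _ , cons uv _ = _ , _ , uv

generator-nonempty : ∀ {n} (X : Graph n) {S} → Connected X → 2 ≤ n →
                     IsLocalMetricGenerator X S → ∃[ s ] s ∈ S
generator-nonempty X connected 2≤n generator with edge-exists X connected 2≤n
... | u , v , uv with generator u v uv
...   | s , s∈S , _ = s , s∈S

Dist-contract-≤ : ∀ {m n} {X : Graph m} {Y : Graph n} (π : Fin m → Fin n) →
  (∀ {u v} → Adj X u v → Adj⁼ Y (π u) (π v)) →
  ∀ {u v d l} → Dist Y (π u) (π v) d → Walk X u v l → d ≤ l
Dist-contract-≤ {Y = Y} π hom (_ , shortest) p with contract p
  where
  contract : ∀ {u v l} → Walk _ u v l → ∃[ l′ ] l′ ≤ l × Walk Y (π u) (π v) l′
  contract nil = 0 , z≤n , nil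
  contract (cons uw p) with contract p | hom uw
  ... | l , l≤ , q | inj₁ πw≡πu = l , m≤n⇒m≤1+n l≤ , subst (λ z → Walk Y z (π _) l) πw≡πu q
  ... | l , l≤ , q | inj₂ πuπw = suc l , s≤s l≤ , cons πuπw q
... | l , l≤ , q = ≤-trans (shortest l q) l≤

injectiveOn∁⇒≤ : ∀ {N M} (p : Subset N) (g : Fin N → Fin M) →
  (∀ x y → x ∉ p → y ∉ p → g x ≡ g y → x ≡ y) → N ≤ ∣ p ∣ + M
injectiveOn∁⇒≤ {M = M} p g injective =
  subst (λ m → _ ≤ ∣ p ∣ + m) (∣⊤∣≡n M) (into p ⊤ g (λ _ _ → ∈⊤) injective)
  where
  into : ∀ {N} (p : Subset N) (q : Subset M) (g : Fin N → Fin M) → (∀ x → x ∉ p → g x ∈ q) →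
         (∀ x y → x ∉ p → y ∉ p → g x ≡ g y → x ≡ y) → N ≤ ∣ p ∣ + ∣ q ∣
  into [] q g _ _ = z≤n
  into (inside ∷ p) q g maps injective =
    s≤s (into p q (g ∘ Fin.suc) (λ x x∉p → maps (Fin.suc x) λ { (there x∈p) → x∉p x∈p })
              (λ x y x∉p y∉p → suc-injective ∘ injective (Fin.suc x) (Fin.suc y)
                (λ { (there x∈p) → x∉p x∈p }) (λ { (there y∈p) → y∉p y∈p })))
  into {suc N} (outside ∷ p) q g maps injective = begin
      suc N                          ≤⟨ s≤s rest ⟩
      suc (∣ p ∣ + ∣ q - g Fin.zero ∣) ≡⟨ sym (+-suc ∣ p ∣ _) ⟩
      ∣ p ∣ + suc ∣ q - g Fin.zero ∣   ≤⟨ +-monoʳ-≤ ∣ p ∣ (x∈p⇒∣p-x∣<∣p∣ (maps Fin.zero λ ())) ⟩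
      ∣ p ∣ + ∣ q ∣                    ∎
    where
    open ≤-Reasoning
    suc∉ : ∀ {x} → x ∉ p → Fin.suc x ∉ outside ∷ p
    suc∉ x∉p (there x∈p) = x∉p x∈p
    -- g 0 is used up by the vertex 0 ∉ p, so the remaining vertices map into q - g 0
    rest : N ≤ ∣ p ∣ + ∣ q - g Fin.zero ∣
    rest = into p (q - g Fin.zero) (g ∘ Fin.suc)
      (λ x x∉p → x∈p∧x≢y⇒x∈p-y (maps (Fin.suc x) (suc∉ x∉p))
                   (λ g1+x≡g0 → 0≢1+n (sym (injective (Fin.suc x) Fin.zero (suc∉ x∉p) (λ ()) g1+x≡g0))))
      (λ x y x∉p y∉p → suc-injective ∘ injective (Fin.suc x) (Fin.suc y) (suc∉ x∉p) (suc∉ y∉p))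

generator-lowerBound : ∀ {N M} (X : Graph N) (class : Fin N → Fin M) →
  (∀ x y → class x ≡ class y → TrueTwins X x y) →
  ∀ S → IsLocalMetricGenerator X S → N ∸ M ≤ ∣ S ∣
generator-lowerBound {N} {M} X class class-twins S generator =
  m≤n+o⇒m∸n≤o N M (subst (N ≤_) (+-comm ∣ S ∣ M) (injectiveOn∁⇒≤ S class separated))
  where
  separated : ∀ x y → x ∉ S → y ∉ S → class x ≡ class y → x ≡ y
  separated x y x∉S y∉S same = generator-meets-trueTwins X generator (class-twins x y same) x∉S y∉S

∣++∣ : ∀ {m n} (p : Subset m) (q : Subset n) → ∣ p ++ q ∣ ≡ ∣ p ∣ + ∣ q ∣
∣++∣ [] q = refl
∣++∣ (inside ∷ p) q = cong suc (∣++∣ p q)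
∣++∣ (outside ∷ p) q = ∣++∣ p q

∣concat-replicate∣ : ∀ {m} k (p : Subset m) → ∣ concat (map (replicate k) p) ∣ ≡ k * ∣ p ∣
∣concat-replicate∣ k [] = sym (*-zeroʳ k)
∣concat-replicate∣ k (inside ∷ p) = begin
  ∣ replicate k inside ++ _ ∣ ≡⟨ ∣++∣ (replicate k inside) _ ⟩
  ∣ ⊤ {k} ∣ + _               ≡⟨ cong₂ _+_ (∣⊤∣≡n k) (∣concat-replicate∣ k p) ⟩
  k + k * ∣ p ∣               ≡⟨ sym (*-suc k _) ⟩
  k * suc ∣ p ∣               ∎
  where open ≡-Reasoning
∣concat-replicate∣ k (outside ∷ p) =
  trans (∣++∣ (replicate k outside) _) (cong₂ _+_ (∣⊥∣≡0 k) (∣concat-replicate∣ k p))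

module StrongProduct {n₁ n₂ : ℕ} (G : Graph n₁) (H : Graph n₂) where

  ⟨_,_⟩ : Fin n₁ → Fin n₂ → Fin (n₁ * n₂)
  ⟨ a , b ⟩ = combine a b

  fst : Fin (n₁ * n₂) → Fin n₁
  fst i = proj₁ (remQuot {n₁} n₂ i)

  snd : Fin (n₁ * n₂) → Fin n₂
  snd i = proj₂ (remQuot {n₁} n₂ i)

  fst-⟨⟩ : ∀ a b → fst ⟨ a , b ⟩ ≡ a
  fst-⟨⟩ a b = cong proj₁ (remQuot-combine {n₁} a b)

  snd-⟨⟩ : ∀ a b → snd ⟨ a , b ⟩ ≡ b
  snd-⟨⟩ a b = cong proj₂ (remQuot-combine {n₁} a b)

  ⟨fst,snd⟩ : ∀ i → ⟨ fst i , snd i ⟩ ≡ i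
  ⟨fst,snd⟩ = combine-remQuot {n₁} n₂

  ⟨⟩-injective : ∀ {a b c d} → ⟨ a , b ⟩ ≡ ⟨ c , d ⟩ → a ≡ c × b ≡ d
  ⟨⟩-injective {a} {b} {c} {d} = combine-injective a b c d

  ≡-by-components : ∀ {i j} → fst i ≡ fst j → snd i ≡ snd j → i ≡ j
  ≡-by-components {i} {j} fst≡ snd≡ =
    trans (sym (⟨fst,snd⟩ i)) (trans (cong₂ ⟨_,_⟩ fst≡ snd≡) (⟨fst,snd⟩ j))

  -- the Boolean adjacency of G ⊠ H from Defs (private there), in components
  private
    adjᵇ : Fin n₁ → Fin n₂ → Fin n₁ → Fin n₂ → Bool
    adjᵇ a b c d = (⌊ a ≟ c ⌋ ∧ adj H b d) ∨ (⌊ b ≟ d ⌋ ∧ adj G a c) ∨ (adj G a c ∧ adj H b d)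

    T-≟ : ∀ {m} {u v : Fin m} → T ⌊ u ≟ v ⌋ ⇔ u ≡ v
    T-≟ = mk⇔ toWitness fromWitness

    T-adj : ∀ {m} (X : Graph m) {u v} → T (adj X u v) ⇔ Adj X u v
    T-adj X = T-≡

    adjᵇ⇒ : ∀ a b c d → T (adjᵇ a b c d) → Adj⁼ G a c × Adj⁼ H b d
    adjᵇ⇒ a b c d t with Equivalence.to (T-∨ {⌊ a ≟ c ⌋ ∧ adj H b d}) t
    ... | inj₁ t₁ with Equivalence.to (T-∧ {⌊ a ≟ c ⌋}) t₁
    ...   | a≡c , bd = inj₁ (sym (Equivalence.to T-≟ a≡c)) , inj₂ (Equivalence.to (T-adj H) bd)
    adjᵇ⇒ a b c d t | inj₂ t₂₃ with Equivalence.to (T-∨ {⌊ b ≟ d ⌋ ∧ adj G a c}) t₂₃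
    ... | inj₁ t₂ with Equivalence.to (T-∧ {⌊ b ≟ d ⌋}) t₂
    ...   | b≡d , ac = inj₂ (Equivalence.to (T-adj G) ac) , inj₁ (sym (Equivalence.to T-≟ b≡d))
    adjᵇ⇒ a b c d t | inj₂ t₂₃ | inj₂ t₃ with Equivalence.to (T-∧ {adj G a c}) t₃
    ...   | ac , bd = inj₂ (Equivalence.to (T-adj G) ac) , inj₂ (Equivalence.to (T-adj H) bd)

    ⇒adjᵇ : ∀ a b c d → Adj⁼ G a c → Adj⁼ H b d → (c ≡ a → d ≢ b) → T (adjᵇ a b c d)
    ⇒adjᵇ a b c d (inj₁ c≡a) (inj₁ d≡b) ≢ = ⊥-elim (≢ c≡a d≡b)
    ⇒adjᵇ a b c d (inj₁ c≡a) (inj₂ bd) _ = Equivalence.from (T-∨ {⌊ a ≟ c ⌋ ∧ adj H b d}) (inj₁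
      (Equivalence.from T-∧ (Equivalence.from T-≟ (sym c≡a) , Equivalence.from (T-adj H) bd)))
    ⇒adjᵇ a b c d (inj₂ ac) (inj₁ d≡b) _ = Equivalence.from (T-∨ {⌊ a ≟ c ⌋ ∧ adj H b d}) (inj₂
      (Equivalence.from (T-∨ {⌊ b ≟ d ⌋ ∧ adj G a c}) (inj₁
      (Equivalence.from T-∧ (Equivalence.from T-≟ (sym d≡b) , Equivalence.from (T-adj G) ac)))))
    ⇒adjᵇ a b c d (inj₂ ac) (inj₂ bd) _ = Equivalence.from (T-∨ {⌊ a ≟ c ⌋ ∧ adj H b d}) (inj₂
      (Equivalence.from (T-∨ {⌊ b ≟ d ⌋ ∧ adj G a c}) (inj₂
      (Equivalence.from T-∧ (Equivalence.from (T-adj G) ac , Equivalence.from (T-adj H) bd)))))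

  Adj-⊠⇒ : ∀ {i j} → Adj (G ⊠ H) i j → Adj⁼ G (fst i) (fst j) × Adj⁼ H (snd i) (snd j)
  Adj-⊠⇒ {i} {j} ij = adjᵇ⇒ (fst i) (snd i) (fst j) (snd j) (Equivalence.from T-≡ ij)

  ⇒Adj-⊠ : ∀ {i j} → Adj⁼ G (fst i) (fst j) → Adj⁼ H (snd i) (snd j) → i ≢ j → Adj (G ⊠ H) i j
  ⇒Adj-⊠ {i} {j} ac bd i≢j = Equivalence.to T-≡
    (⇒adjᵇ (fst i) (snd i) (fst j) (snd j) ac bd λ c≡a d≡b → i≢j (≡-by-components (sym c≡a) (sym d≡b)))

  Adj⁼-⊠ : ∀ {i j} → Adj⁼ (G ⊠ H) i j ⇔ (Adj⁼ G (fst i) (fst j) × Adj⁼ H (snd i) (snd j))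
  Adj⁼-⊠ {i} {j} = mk⇔ to from
    where
    to : Adj⁼ (G ⊠ H) i j → Adj⁼ G (fst i) (fst j) × Adj⁼ H (snd i) (snd j)
    to (inj₁ refl) = inj₁ refl , inj₁ refl
    to (inj₂ ij) = Adj-⊠⇒ ij
    from : Adj⁼ G (fst i) (fst j) × Adj⁼ H (snd i) (snd j) → Adj⁼ (G ⊠ H) i j
    from (ac , bd) with j ≟ i
    ... | yes j≡i = inj₁ j≡i
    ... | no j≢i = inj₂ (⇒Adj-⊠ ac bd (j≢i ∘ sym))

  trueTwins-⊠ : ∀ {i j} → TrueTwins G (fst i) (fst j) → snd i ≡ snd j → TrueTwins (G ⊠ H) i j
  trueTwins-⊠ {i} {j} twins snd≡ w =
    ⇔-trans Adj⁼-⊠ (⇔-trans (twins (fst w) ×-⇔ sameH) (⇔-sym Adj⁼-⊠))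
    where
    sameH : Adj⁼ H (snd i) (snd w) ⇔ Adj⁼ H (snd j) (snd w)
    sameH = subst (λ b → Adj⁼ H (snd i) (snd w) ⇔ Adj⁼ H b (snd w)) snd≡ ⇔-refl

  -- (b , class of a) determines the true twin class of (a , b)
  generator-⊠-lowerBound : ∀ {t} → TrueTwinClasses G t →
    ∀ S → IsLocalMetricGenerator (G ⊠ H) S → n₂ * (n₁ ∸ t) ≤ ∣ S ∣
  generator-⊠-lowerBound {t} (class , _ , class⇔twins) S generator =
    subst (_≤ ∣ S ∣) count (generator-lowerBound (G ⊠ H) class-⊠ class-⊠-twins S generator)
    where
    class-⊠ : Fin (n₁ * n₂) → Fin (n₂ * t)
    class-⊠ i = combine (snd i) (class (fst i))
    class-⊠-twins : ∀ i j → class-⊠ i ≡ class-⊠ j → TrueTwins (G ⊠ H) i j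
    class-⊠-twins i j same with combine-injective (snd i) (class (fst i)) (snd j) (class (fst j)) same
    ... | snd≡ , class≡ = trueTwins-⊠ (Equivalence.to (class⇔twins (fst i) (fst j)) class≡) snd≡
    count : n₁ * n₂ ∸ n₂ * t ≡ n₂ * (n₁ ∸ t)
    count = trans (cong (_∸ n₂ * t) (*-comm n₁ n₂)) (sym (*-distribˡ-∸ n₂ n₁ t))

  Adj-⟨⟩ : ∀ {a b c d} → Adj⁼ G a c → Adj⁼ H b d → ⟨ a , b ⟩ ≢ ⟨ c , d ⟩ →
           Adj (G ⊠ H) ⟨ a , b ⟩ ⟨ c , d ⟩
  Adj-⟨⟩ {a} {b} {c} {d} ac bd = ⇒Adj-⊠
    (subst₂ (Adj⁼ G) (sym (fst-⟨⟩ a b)) (sym (fst-⟨⟩ c d)) ac)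
    (subst₂ (Adj⁼ H) (sym (snd-⟨⟩ a b)) (sym (snd-⟨⟩ c d)) bd)

  Walk-⊠ˡ : ∀ {a c b α} → Walk G a c α → Walk (G ⊠ H) ⟨ a , b ⟩ ⟨ c , b ⟩ α
  Walk-⊠ˡ nil = nil
  Walk-⊠ˡ (cons ac p) =
    cons (Adj-⟨⟩ (inj₂ ac) (inj₁ refl) (Adj⇒≢ G ac ∘ proj₁ ∘ ⟨⟩-injective)) (Walk-⊠ˡ p)

  Walk-⊠ʳ : ∀ {a b d β} → Walk H b d β → Walk (G ⊠ H) ⟨ a , b ⟩ ⟨ a , d ⟩ β
  Walk-⊠ʳ nil = nil
  Walk-⊠ʳ (cons bd p) =
    cons (Adj-⟨⟩ (inj₁ refl) (inj₂ bd) (Adj⇒≢ H bd ∘ proj₂ ∘ ⟨⟩-injective)) (Walk-⊠ʳ p)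

  Walk-⊠ : ∀ {a b c d α β} → Walk G a c α → Walk H b d β →
           Walk (G ⊠ H) ⟨ a , b ⟩ ⟨ c , d ⟩ (α ⊔ β)
  Walk-⊠ nil q = Walk-⊠ʳ q
  Walk-⊠ p@(cons _ _) nil = Walk-⊠ˡ p
  Walk-⊠ (cons ac p) (cons bd q) =
    cons (Adj-⟨⟩ (inj₂ ac) (inj₂ bd) (Adj⇒≢ G ac ∘ proj₁ ∘ ⟨⟩-injective)) (Walk-⊠ p q)

  Dist-⊠ : ∀ {a b i α β} → Dist G a (fst i) α → Dist H b (snd i) β →
           Dist (G ⊠ H) ⟨ a , b ⟩ i (α ⊔ β)
  Dist-⊠ {a} {b} {i} aa′@(p , _) bb′@(q , _) =
    subst (λ j → Walk (G ⊠ H) ⟨ a , b ⟩ j _) (⟨fst,snd⟩ i) (Walk-⊠ p q) ,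
    λ m r → ⊔-lub
      (Dist-contract-≤ fst (proj₁ ∘ Adj-⊠⇒) (subst (λ x → Dist G x _ _) (sym (fst-⟨⟩ a b)) aa′) r)
      (Dist-contract-≤ snd (proj₂ ∘ Adj-⊠⇒) (subst (λ y → Dist H y _ _) (sym (snd-⟨⟩ a b)) bb′) r)

  lift : Subset n₁ → Subset (n₁ * n₂)
  lift S = concat (map (replicate n₂) S)

  ∣lift∣ : ∀ S → ∣ lift S ∣ ≡ n₂ * ∣ S ∣
  ∣lift∣ = ∣concat-replicate∣ n₂

  ⟨⟩∈lift : ∀ {S s} w → s ∈ S → ⟨ s , w ⟩ ∈ lift S
  ⟨⟩∈lift {S} {s} w s∈S = lookup⇒[]= _ (lift S) (begin
    lookup (lift S) ⟨ s , w ⟩                ≡⟨ lookup-concat (map (replicate n₂) S) s w ⟩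
    lookup (lookup (map (replicate n₂) S) s) w ≡⟨ cong (λ v → lookup v w) (lookup-map s (replicate n₂) S) ⟩
    lookup (replicate n₂ (lookup S s)) w     ≡⟨ lookup-replicate w _ ⟩
    lookup S s                               ≡⟨ []=⇒lookup s∈S ⟩
    inside                                   ∎)
    where open ≡-Reasoning

  distinguish-via-G : ∀ {s x y} → Distinguishes G s (fst x) (fst y) → snd x ≡ snd y →
                      Distinguishes (G ⊠ H) ⟨ s , snd x ⟩ x y
  distinguish-via-G {x = x} (α , γ , sx , sy , α≢γ) snd≡ =
    α ⊔ 0 , γ ⊔ 0 , Dist-⊠ sx (Dist-refl H) ,
    Dist-⊠ sy (subst (λ b → Dist H (snd x) b 0) snd≡ (Dist-refl H)) ,
    λ α⊔0≡γ⊔0 → α≢γ (trans (sym (⊔-identityʳ α)) (trans α⊔0≡γ⊔0 (⊔-identityʳ γ)))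

  -- both G-distances are below k ≤ 1 + c, so the H-distances c and 1 + c are the maxima
  distinguish-via-H : ∀ {k s w x y c} → Connected G → DiameterLt G k → k ≤ suc c →
    Dist H w (snd x) c → Dist H w (snd y) (suc c) → Distinguishes (G ⊠ H) ⟨ s , w ⟩ x y
  distinguish-via-H {s = s} {x = x} {y} {c} connected diameter k≤1+c wx wy
    with Dist-exists G connected s (fst x) | Dist-exists G connected s (fst y)
  ... | α , sx | γ , sy = α ⊔ c , γ ⊔ suc c , Dist-⊠ sx wx , Dist-⊠ sy wy , λ same → 1+n≢n (sym (begin
      c         ≡⟨ sym (m≤n⇒m⊔n≡n α≤c) ⟩
      α ⊔ c     ≡⟨ same ⟩
      γ ⊔ suc c ≡⟨ m≤n⇒m⊔n≡n γ≤1+c ⟩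
      suc c     ∎))
    where
    open ≡-Reasoning
    α≤c : α ≤ c
    α≤c = s≤s⁻¹ (≤-trans (diameter _ _ _ sx) k≤1+c)
    γ≤1+c : γ ≤ suc c
    γ≤1+c = <⇒≤ (≤-trans (diameter _ _ _ sy) k≤1+c)

  lift-isLocalMetricGenerator : ∀ {k S s₀} → Connected G → AdjacencyResolved H k →
    DiameterLt G k → s₀ ∈ S → IsLocalMetricGenerator G S → IsLocalMetricGenerator (G ⊠ H) (lift S)
  lift-isLocalMetricGenerator connected resolved diameter s₀∈S generator x y xy with Adj-⊠⇒ xy
  ... | inj₁ c≡a , inj₁ d≡b = ⊥-elim (Adj⇒≢ (G ⊠ H) xy (≡-by-components (sym c≡a) (sym d≡b)))
  ... | inj₂ ac , inj₁ d≡b with generator _ _ ac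
  ...   | s , s∈S , separates = ⟨ s , snd x ⟩ , ⟨⟩∈lift _ s∈S , distinguish-via-G separates (sym d≡b)
  lift-isLocalMetricGenerator connected resolved diameter s₀∈S generator x y xy
      | _ , inj₂ bd with adjacencyResolved⇒far H resolved bd
  ... | w , c , k≤1+c , inj₁ (wx , wy) =
    ⟨ _ , w ⟩ , ⟨⟩∈lift w s₀∈S , distinguish-via-H connected diameter k≤1+c wx wy
  ... | w , c , k≤1+c , inj₂ (wy , wx) =
    ⟨ _ , w ⟩ , ⟨⟩∈lift w s₀∈S ,
    Distinguishes-sym (G ⊠ H) (distinguish-via-H connected diameter k≤1+c wy wx)

theorem13 : (n₁ n₂ k t₁ : ℕ) (G : Graph n₁) (H : Graph n₂) →
    Connected G → Connected H → 2 ≤ n₁ →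
    AdjacencyResolved H k →
    TrueTwinClasses G t₁ →
    DiameterLt G k →
    LocalMetricDim G (n₁ ∸ t₁) →
    LocalMetricDim (G ⊠ H) (n₂ * (n₁ ∸ t₁))
theorem13 n₁ n₂ k t₁ G H connected _ 2≤n₁ resolved classes diameter ((S , generator , ∣S∣≡) , _)
  with generator-nonempty G connected 2≤n₁ generator
... | _ , s₀∈S =
  (lift S , lift-isLocalMetricGenerator connected resolved diameter s₀∈S generator ,
   trans (∣lift∣ S) (cong (n₂ *_) ∣S∣≡)) ,
  generator-⊠-lowerBound classes
  where open StrongProduct G H
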